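{- For all integers $n,p\ge0$, \[ B_{n,\lambda}^{(p)}(x)=\sum_{k=0}^{n}\frac{1}{\binom{k+p}{p}}\,S_{2,\lambda}(n,k\,|\,x). \]
   Context: Let $\lambda\in\mathbb{R}$. Set $(x)_{0,\lambda}=1$, $(x)_{n,\lambda}=x(x-\lambda)\cdots(x-(n-1)\lambda)$ for $n\ge1$; $(y)_0=1$, $(y)_n=y(y-1)\cdots(y-n+1)$. The degenerate exponential is the formal power series $e_\lambda^x(t)=\sum_{n\ge0}(x)_{n,\lambda}\frac{t^n}{n!}$ ($=(1+\lambda t)^{x/\lambda}$, and $e^{xt}$ if $\lambda=0$), $e_\lambda(t)=e_\lambda^1(t)$. The degenerate Stirling polynomials of the second kind $S_{2,\lambda}(n,k\,|\,x)$ are defined by $(y+x)_{n,\lambda}=\sum_{k=0}^n S_{2,\lambda}(n,k\,|\,x)(y)_k$ for all $y$. For an integer $p\ge0$, the truncated degenerate modified Bell polynomials $B^{(p)}_{n,\lambda}(x)$ are defined by \[\frac{p!}{(e_\lambda(t)-1)^p}\Big(e^{e_\lambda(t)-1}-\sum_{l=0}^{p-1}\frac{(e_\lambda(t)-1)^l}{l!}\Big)e_\lambda^x(t)=\sum_{n\ge0}B^{(p)}_{n,\lambda}(x)\frac{t^n}{n!},\] where the left side is, as a formal power series, $p!\sum_{k\ge0}\frac{(e_\lambda(t)-1)^k}{(k+p)!}e_\lambda^x(t)$.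
   Formalization: The parameters λ and x are rational rather than real, and so is the variable y in the defining identity of $S_{2,\lambda}(n,k\,|\,x)$. -}

module Defs where

open import Data.Nat as ℕ using (ℕ; zero; suc; _!; _∸_)
open import Data.Nat.Combinatorics using (_C_)
open import Data.Integer using (+_)
open import Data.Rational using (ℚ; 0ℚ; 1ℚ; _+_; _*_; _-_; _/_)

ℕ→ℚ : ℕ → ℚ
ℕ→ℚ n = + n / 1

-- reciprocal of a natural number (only ever applied to positive
-- numbers below: factorials and binomial coefficients C(k+p,p) ≥ 1)
invℕ : ℕ → ℚ
invℕ zero    = 0ℚ
invℕ (suc m) = + 1 / suc m

Σ≤ : ℕ → (ℕ → ℚ) → ℚ
Σ≤ zero    f = f 0
Σ≤ (suc n) f = Σ≤ n f + f (suc n)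

fallλ : ℚ → ℚ → ℕ → ℚ
fallλ lam x zero    = 1ℚ
fallλ lam x (suc n) = fallλ lam x n * (x - ℕ→ℚ n * lam)

fall : ℚ → ℕ → ℚ
fall y n = fallλ 1ℚ y n

-- formal power series in t, as the sequence of ordinary coefficients
-- (coefficient of t^n)
Series : Set
Series = ℕ → ℚ

_⊛_ : Series → Series → Series
(f ⊛ g) n = Σ≤ n (λ i → f i * g (n ∸ i))

one : Series
one zero    = 1ℚ
one (suc n) = 0ℚ

_^ₛ_ : Series → ℕ → Series
s ^ₛ zero  = one
s ^ₛ suc k = (s ^ₛ k) ⊛ s

eλ^ : ℚ → ℚ → Series
eλ^ lam x n = fallλ lam x n * invℕ (n !)

eλ-1 : ℚ → Series
eλ-1 lam zero    = 0ℚ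
eλ-1 lam (suc n) = eλ^ lam 1ℚ (suc n)

-- the generating function  p! Σ_{k≥0} (e_λ(t)-1)^k/(k+p)! · e_λ^x(t).
-- The k-th summand has order ≥ k in t, so the coefficient of t^n of the
-- (formally summable) infinite sum is the finite sum over k = 0..n.
truncBellGF : ℕ → ℚ → ℚ → Series
truncBellGF p lam x n =
  ℕ→ℚ (p !) * Σ≤ n (λ k → invℕ ((k ℕ.+ p) !) * ((eλ-1 lam ^ₛ k) ⊛ eλ^ lam x) n)

B : ℕ → ℚ → ℕ → ℚ → ℚ
B p lam n x = ℕ→ℚ (n !) * truncBellGF p lam x n

IsDegStirling2 : ℚ → ℚ → (ℕ → ℕ → ℚ) → Set
IsDegStirling2 lam x S =
  ∀ (n : ℕ) (y : ℚ) → fallλ lam (y + x) n ≡ Σ≤ n (λ k → S n k * fall y k)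
  where open import Relation.Binary.PropositionalEquality using (_≡_)

-- With A k = [t^n] (e_λ(t) - 1)^k e_λ^x(t), B^{(p)}_{n,λ}(x) is n! p! Σ_k A k / (k+p)!,
-- and 1 / C(k+p,p) = p! k! / (k+p)!, so it suffices that S_{2,λ}(n,k|x) = (n!/k!) A k.
-- These numbers satisfy the defining identity at every natural y = m: expanding
-- e_λ(t)^m = (1 + (e_λ(t) - 1))^m binomially and using e_λ^m(t) e_λ^x(t) = e_λ^{m+x}(t)
-- gives Σ_k (n!/k!) A k (m)_k = (m+x)_{n,λ}.  The values y = 0, ..., n already determine
-- the coefficients of an expansion in falling factorials, since (m)_k = 0 for k > m
-- and (m)_m = m! make the system triangular.

{-# OPTIONS --safe #-}
module Submission where

open import Defs
open import Data.Nat using (ℕ; _+_)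
open import Data.Nat.Combinatorics using (_C_)
open import Data.Rational using (ℚ; _*_)
open import Relation.Binary.PropositionalEquality using (_≡_)

open import Data.Nat as ℕ using (zero; suc; _!; _∸_; NonZero; z≤n; s≤s; _≤_; _<_)
import Data.Nat.Properties as ℕP
open import Data.Nat.Combinatorics using (nCk≡n!/k![n-k]!; k![n∸k]!∣n!)
open import Data.Nat.DivMod using (m/n*n≡m)
open import Data.Nat.Induction using (<-rec)
open import Data.Integer as ℤ using (+_)
import Data.Integer.Properties as ℤP
open import Data.Nat.Coprimality using (1-coprimeTo) renaming (sym to coprime-sym)
open import Data.Rational using (0ℚ; 1ℚ; mkℚ; _/_; 1/_) renaming (_+_ to _+ℚ_; _-_ to _-ℚ_)
import Data.Rational.Properties as QP
open import Algebra.Properties.Group QP.+-0-group using (x∙y⁻¹≈ε⇒x≈y)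
open import Data.Rational.Solver using (module +-*-Solver)
open +-*-Solver using (solve; _:+_; _:*_; _:-_; _:=_; con)
open import Data.Sum using (inj₁; inj₂)
open import Relation.Nullary using (yes; no; contradiction)
open import Relation.Binary.Definitions using (tri<; tri≈; tri>)
open import Relation.Binary.PropositionalEquality
  using (refl; sym; trans; cong; cong₂; subst; _≢_; module ≡-Reasoning)
open ≡-Reasoning

ℕ→ℚ-suc : ∀ n → ℕ→ℚ (suc n) ≡ 1ℚ +ℚ ℕ→ℚ n
ℕ→ℚ-suc n rewrite QP.↥p/↧p≡p (mkℚ (+ n) 0 (coprime-sym (1-coprimeTo n))) =
  cong (λ m → (+ 1 ℤ.+ m) / 1) (sym (ℤP.*-identityʳ (+ n)))

ℕ→ℚ-+ : ∀ m n → ℕ→ℚ (m + n) ≡ ℕ→ℚ m +ℚ ℕ→ℚ n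
ℕ→ℚ-+ zero    n = sym (QP.+-identityˡ (ℕ→ℚ n))
ℕ→ℚ-+ (suc m) n = begin
  ℕ→ℚ (suc (m + n))        ≡⟨ ℕ→ℚ-suc (m + n) ⟩
  1ℚ +ℚ ℕ→ℚ (m + n)        ≡⟨ cong (1ℚ +ℚ_) (ℕ→ℚ-+ m n) ⟩
  1ℚ +ℚ (ℕ→ℚ m +ℚ ℕ→ℚ n)   ≡⟨ QP.+-assoc 1ℚ (ℕ→ℚ m) (ℕ→ℚ n) ⟨
  (1ℚ +ℚ ℕ→ℚ m) +ℚ ℕ→ℚ n   ≡⟨ cong (_+ℚ ℕ→ℚ n) (ℕ→ℚ-suc m) ⟨
  ℕ→ℚ (suc m) +ℚ ℕ→ℚ n     ∎

ℕ→ℚ-* : ∀ m n → ℕ→ℚ (m ℕ.* n) ≡ ℕ→ℚ m * ℕ→ℚ n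
ℕ→ℚ-* zero    n = sym (QP.*-zeroˡ (ℕ→ℚ n))
ℕ→ℚ-* (suc m) n = begin
  ℕ→ℚ (n + m ℕ.* n)          ≡⟨ ℕ→ℚ-+ n (m ℕ.* n) ⟩
  ℕ→ℚ n +ℚ ℕ→ℚ (m ℕ.* n)     ≡⟨ cong (ℕ→ℚ n +ℚ_) (ℕ→ℚ-* m n) ⟩
  ℕ→ℚ n +ℚ ℕ→ℚ m * ℕ→ℚ n     ≡⟨ solve 2 (λ M N → N :+ M :* N := (con 1ℚ :+ M) :* N) refl (ℕ→ℚ m) (ℕ→ℚ n) ⟩
  (1ℚ +ℚ ℕ→ℚ m) * ℕ→ℚ n      ≡⟨ cong (_* ℕ→ℚ n) (ℕ→ℚ-suc m) ⟨
  ℕ→ℚ (suc m) * ℕ→ℚ n        ∎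

ℕ→ℚ-∸ : ∀ {m n} → n ≤ m → ℕ→ℚ (m ∸ n) ≡ ℕ→ℚ m -ℚ ℕ→ℚ n
ℕ→ℚ-∸ {m} {n} n≤m = begin
  ℕ→ℚ (m ∸ n)                       ≡⟨ solve 2 (λ D N → D := (N :+ D) :- N) refl (ℕ→ℚ (m ∸ n)) (ℕ→ℚ n) ⟩
  (ℕ→ℚ n +ℚ ℕ→ℚ (m ∸ n)) -ℚ ℕ→ℚ n   ≡⟨ cong (_-ℚ ℕ→ℚ n) (ℕ→ℚ-+ n (m ∸ n)) ⟨
  ℕ→ℚ (n + (m ∸ n)) -ℚ ℕ→ℚ n        ≡⟨ cong (λ k → ℕ→ℚ k -ℚ ℕ→ℚ n) (ℕP.m+[n∸m]≡n n≤m) ⟩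
  ℕ→ℚ m -ℚ ℕ→ℚ n                    ∎

ℕ→ℚ*invℕ≡1 : ∀ n .{{_ : NonZero n}} → ℕ→ℚ n * invℕ n ≡ 1ℚ
ℕ→ℚ*invℕ≡1 (suc n) = trans (cong₂ _*_ (QP.↥p/↧p≡p q) (QP.↥p/↧p≡p (1/ q))) (QP.*-inverseʳ q)
  where q = mkℚ (+ suc n) 0 (coprime-sym (1-coprimeTo (suc n)))

invℕ*ℕ→ℚ*x≡x : ∀ n .{{_ : NonZero n}} x → invℕ n * (ℕ→ℚ n * x) ≡ x
invℕ*ℕ→ℚ*x≡x n x = begin
  invℕ n * (ℕ→ℚ n * x)   ≡⟨ solve 3 (λ I N x → I :* (N :* x) := (N :* I) :* x) refl (invℕ n) (ℕ→ℚ n) x ⟩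
  (ℕ→ℚ n * invℕ n) * x   ≡⟨ cong (_* x) (ℕ→ℚ*invℕ≡1 n) ⟩
  1ℚ * x                 ≡⟨ QP.*-identityˡ x ⟩
  x                      ∎

ℕ→ℚ-*-cancelˡ : ∀ n .{{_ : NonZero n}} {x y} → ℕ→ℚ n * x ≡ ℕ→ℚ n * y → x ≡ y
ℕ→ℚ-*-cancelˡ n {x} {y} eq =
  trans (sym (invℕ*ℕ→ℚ*x≡x n x)) (trans (cong (invℕ n *_) eq) (invℕ*ℕ→ℚ*x≡x n y))

invℕ-* : ∀ m n .{{_ : NonZero m}} .{{_ : NonZero n}} → invℕ (m ℕ.* n) ≡ invℕ m * invℕ n
invℕ-* m n = ℕ→ℚ-*-cancelˡ (m ℕ.* n) {{mn≢0}} (begin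
  ℕ→ℚ (m ℕ.* n) * invℕ (m ℕ.* n)        ≡⟨ ℕ→ℚ*invℕ≡1 (m ℕ.* n) {{mn≢0}} ⟩
  1ℚ                                    ≡⟨ cong₂ _*_ (ℕ→ℚ*invℕ≡1 m) (ℕ→ℚ*invℕ≡1 n) ⟨
  (ℕ→ℚ m * invℕ m) * (ℕ→ℚ n * invℕ n)   ≡⟨ solve 4 (λ M N I J → (M :* I) :* (N :* J) := (M :* N) :* (I :* J))
                                              refl (ℕ→ℚ m) (ℕ→ℚ n) (invℕ m) (invℕ n) ⟩
  (ℕ→ℚ m * ℕ→ℚ n) * (invℕ m * invℕ n)   ≡⟨ cong (_* (invℕ m * invℕ n)) (ℕ→ℚ-* m n) ⟨
  ℕ→ℚ (m ℕ.* n) * (invℕ m * invℕ n)     ∎)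
  where mn≢0 = ℕP.m*n≢0 m n

-- Finite sums

Σ≤-cong : ∀ n {f g : ℕ → ℚ} → (∀ i → i ≤ n → f i ≡ g i) → Σ≤ n f ≡ Σ≤ n g
Σ≤-cong zero    f≡g = f≡g 0 z≤n
Σ≤-cong (suc n) f≡g =
  cong₂ _+ℚ_ (Σ≤-cong n (λ i i≤n → f≡g i (ℕP.m≤n⇒m≤1+n i≤n))) (f≡g (suc n) ℕP.≤-refl)

Σ≤-zero : ∀ n {f : ℕ → ℚ} → (∀ i → i ≤ n → f i ≡ 0ℚ) → Σ≤ n f ≡ 0ℚ
Σ≤-zero zero    f≡0 = f≡0 0 z≤n
Σ≤-zero (suc n) f≡0 =
  cong₂ _+ℚ_ (Σ≤-zero n (λ i i≤n → f≡0 i (ℕP.m≤n⇒m≤1+n i≤n))) (f≡0 (suc n) ℕP.≤-refl)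

Σ≤-distrib-+ : ∀ n (f g : ℕ → ℚ) → Σ≤ n (λ i → f i +ℚ g i) ≡ Σ≤ n f +ℚ Σ≤ n g
Σ≤-distrib-+ zero    f g = refl
Σ≤-distrib-+ (suc n) f g = trans (cong (_+ℚ (f (suc n) +ℚ g (suc n))) (Σ≤-distrib-+ n f g))
  (solve 4 (λ a b c d → (a :+ b) :+ (c :+ d) := (a :+ c) :+ (b :+ d)) refl
    (Σ≤ n f) (Σ≤ n g) (f (suc n)) (g (suc n)))

Σ≤-distrib-- : ∀ n (f g : ℕ → ℚ) → Σ≤ n (λ i → f i -ℚ g i) ≡ Σ≤ n f -ℚ Σ≤ n g
Σ≤-distrib-- zero    f g = refl
Σ≤-distrib-- (suc n) f g = trans (cong (_+ℚ (f (suc n) -ℚ g (suc n))) (Σ≤-distrib-- n f g))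
  (solve 4 (λ a b c d → (a :- b) :+ (c :- d) := (a :+ c) :- (b :+ d)) refl
    (Σ≤ n f) (Σ≤ n g) (f (suc n)) (g (suc n)))

*-distribˡ-Σ≤ : ∀ n c (f : ℕ → ℚ) → c * Σ≤ n f ≡ Σ≤ n (λ i → c * f i)
*-distribˡ-Σ≤ zero    c f = refl
*-distribˡ-Σ≤ (suc n) c f =
  trans (QP.*-distribˡ-+ c (Σ≤ n f) (f (suc n))) (cong (_+ℚ c * f (suc n)) (*-distribˡ-Σ≤ n c f))

*-distribʳ-Σ≤ : ∀ n c (f : ℕ → ℚ) → Σ≤ n f * c ≡ Σ≤ n (λ i → f i * c)
*-distribʳ-Σ≤ n c f = trans (QP.*-comm (Σ≤ n f) c)
  (trans (*-distribˡ-Σ≤ n c f) (Σ≤-cong n (λ i _ → QP.*-comm c (f i))))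

Σ≤-shift : ∀ n (f : ℕ → ℚ) → Σ≤ (suc n) f ≡ f 0 +ℚ Σ≤ n (λ i → f (suc i))
Σ≤-shift zero    f = refl
Σ≤-shift (suc n) f = trans (cong (_+ℚ f (suc (suc n))) (Σ≤-shift n f))
  (QP.+-assoc (f 0) (Σ≤ n (λ i → f (suc i))) (f (suc (suc n))))

Σ≤-trailing-zeros : ∀ {m} n {f : ℕ → ℚ} → m ≤ n → (∀ i → m < i → f i ≡ 0ℚ) → Σ≤ n f ≡ Σ≤ m f
Σ≤-trailing-zeros zero    z≤n     _   = refl
Σ≤-trailing-zeros (suc n) {f} m≤1+n f≡0 with ℕP.m≤n⇒m<n∨m≡n m≤1+n
... | inj₂ refl  = refl
... | inj₁ m<1+n = trans (cong₂ _+ℚ_ (Σ≤-trailing-zeros n (ℕ.s≤s⁻¹ m<1+n) f≡0) (f≡0 (suc n) m<1+n))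
  (QP.+-identityʳ _)

Σ≤-swap : ∀ n m (h : ℕ → ℕ → ℚ) →
  Σ≤ n (λ i → Σ≤ m (λ k → h i k)) ≡ Σ≤ m (λ k → Σ≤ n (λ i → h i k))
Σ≤-swap n zero    h = refl
Σ≤-swap n (suc m) h = trans (Σ≤-distrib-+ n (λ i → Σ≤ m (h i)) (λ i → h i (suc m)))
  (cong (_+ℚ Σ≤ n (λ i → h i (suc m))) (Σ≤-swap n m h))

Σ≤-single : ∀ n m (f : ℕ → ℚ) → m ≤ n → (∀ i → i ≤ n → i ≢ m → f i ≡ 0ℚ) → Σ≤ n f ≡ f m
Σ≤-single zero    .zero f z≤n f≡0 = refl
Σ≤-single (suc n) m     f m≤1+n f≡0 with m ℕ.≟ suc n
... | yes refl = trans (cong (_+ℚ f (suc n)) (Σ≤-zero n (λ i i≤n → f≡0 i (ℕP.m≤n⇒m≤1+n i≤n)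
                   (λ { refl → ℕP.<-irrefl refl (s≤s i≤n) }))))
                   (QP.+-identityˡ (f (suc n)))
... | no m≢1+n = trans (cong₂ _+ℚ_
                   (Σ≤-single n m f (ℕ.s≤s⁻¹ (ℕP.≤∧≢⇒< m≤1+n m≢1+n)) (λ i i≤n → f≡0 i (ℕP.m≤n⇒m≤1+n i≤n)))
                   (f≡0 (suc n) ℕP.≤-refl (λ 1+n≡m → m≢1+n (sym 1+n≡m))))
                   (QP.+-identityʳ (f m))

-- Formal power series

⊛-congˡ : ∀ {f g : Series} (h : Series) → (∀ i → f i ≡ g i) → ∀ n → (f ⊛ h) n ≡ (g ⊛ h) n
⊛-congˡ h f≡g n = Σ≤-cong n (λ i _ → cong (_* h (n ∸ i)) (f≡g i))

⊛-identityʳ : ∀ (f : Series) n → (f ⊛ one) n ≡ f n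
⊛-identityʳ f zero    = QP.*-identityʳ (f 0)
⊛-identityʳ f (suc n) = begin
  Σ≤ n (λ i → f i * one (suc n ∸ i)) +ℚ f (suc n) * one (n ∸ n)
    ≡⟨ cong₂ _+ℚ_ (Σ≤-zero n off-diagonal) (cong (λ j → f (suc n) * one j) (ℕP.n∸n≡0 n)) ⟩
  0ℚ +ℚ f (suc n) * 1ℚ
    ≡⟨ trans (QP.+-identityˡ _) (QP.*-identityʳ (f (suc n))) ⟩
  f (suc n) ∎
  where
  off-diagonal : ∀ i → i ≤ n → f i * one (suc n ∸ i) ≡ 0ℚ
  off-diagonal i i≤n rewrite ℕP.+-∸-assoc 1 i≤n = QP.*-zeroʳ (f i)

⊛-distribˡ-+ : ∀ (f g h : Series) n → (f ⊛ (λ i → g i +ℚ h i)) n ≡ (f ⊛ g) n +ℚ (f ⊛ h) n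
⊛-distribˡ-+ f g h n = trans (Σ≤-cong n (λ i _ → QP.*-distribˡ-+ (f i) (g (n ∸ i)) (h (n ∸ i))))
  (Σ≤-distrib-+ n (λ i → f i * g (n ∸ i)) (λ i → f i * h (n ∸ i)))

⊛-distribʳ-Σ≤ : ∀ m (c : ℕ → ℚ) (F : ℕ → Series) (h : Series) n →
  ((λ i → Σ≤ m (λ k → c k * F k i)) ⊛ h) n ≡ Σ≤ m (λ k → c k * (F k ⊛ h) n)
⊛-distribʳ-Σ≤ m c F h n = begin
  Σ≤ n (λ i → Σ≤ m (λ k → c k * F k i) * h (n ∸ i))
    ≡⟨ Σ≤-cong n (λ i _ → trans (*-distribʳ-Σ≤ m (h (n ∸ i)) (λ k → c k * F k i))
                                (Σ≤-cong m (λ k _ → QP.*-assoc (c k) (F k i) (h (n ∸ i))))) ⟩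
  Σ≤ n (λ i → Σ≤ m (λ k → c k * (F k i * h (n ∸ i))))
    ≡⟨ Σ≤-swap n m (λ i k → c k * (F k i * h (n ∸ i))) ⟩
  Σ≤ m (λ k → Σ≤ n (λ i → c k * (F k i * h (n ∸ i))))
    ≡⟨ Σ≤-cong m (λ k _ → *-distribˡ-Σ≤ n (c k) (λ i → F k i * h (n ∸ i))) ⟨
  Σ≤ m (λ k → c k * (F k ⊛ h) n) ∎

⊛-vanishˡ : ∀ {f : Series} (g : Series) k → (∀ i → i < k → f i ≡ 0ℚ) → ∀ n → n < k → (f ⊛ g) n ≡ 0ℚ
⊛-vanishˡ {f} g k f≡0 n n<k = Σ≤-zero n (λ i i≤n →
  trans (cong (_* g (n ∸ i)) (f≡0 i (ℕP.≤-<-trans i≤n n<k))) (QP.*-zeroˡ (g (n ∸ i))))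

^ₛ-vanish : ∀ (s : Series) → s 0 ≡ 0ℚ → ∀ k n → n < k → (s ^ₛ k) n ≡ 0ℚ
^ₛ-vanish s s₀≡0 (suc k) n n<1+k = Σ≤-zero n term≡0
  where
  term≡0 : ∀ i → i ≤ n → (s ^ₛ k) i * s (n ∸ i) ≡ 0ℚ
  term≡0 i i≤n with i ℕ.<? k
  ... | yes i<k = trans (cong (_* s (n ∸ i)) (^ₛ-vanish s s₀≡0 k i i<k)) (QP.*-zeroˡ (s (n ∸ i)))
  ... | no  i≮k = begin
    (s ^ₛ k) i * s (n ∸ i) ≡⟨ cong (λ j → (s ^ₛ k) i * s j) (ℕP.m≤n⇒m∸n≡0 n≤i) ⟩
    (s ^ₛ k) i * s 0       ≡⟨ cong ((s ^ₛ k) i *_) s₀≡0 ⟩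
    (s ^ₛ k) i * 0ℚ        ≡⟨ QP.*-zeroʳ ((s ^ₛ k) i) ⟩
    0ℚ                     ∎
    where n≤i = ℕP.≤-trans (ℕ.s≤s⁻¹ n<1+k) (ℕP.≮⇒≥ i≮k)

deriv : Series → Series
deriv f j = ℕ→ℚ (suc j) * f (suc j)

deriv-⊛ : ∀ (f g : Series) n → deriv (f ⊛ g) n ≡ (deriv f ⊛ g) n +ℚ (f ⊛ deriv g) n
deriv-⊛ f g n = begin
  N * Σ≤ (suc n) (λ i → f i * g (suc n ∸ i))
    ≡⟨ *-distribˡ-Σ≤ (suc n) N (λ i → f i * g (suc n ∸ i)) ⟩
  Σ≤ (suc n) (λ i → N * (f i * g (suc n ∸ i)))
    ≡⟨ Σ≤-cong (suc n) split ⟩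
  Σ≤ (suc n) (λ i → df-term i +ℚ dg-term i)
    ≡⟨ Σ≤-distrib-+ (suc n) df-term dg-term ⟩
  Σ≤ (suc n) df-term +ℚ Σ≤ (suc n) dg-term
    ≡⟨ cong₂ _+ℚ_ df-sum dg-sum ⟩
  (deriv f ⊛ g) n +ℚ (f ⊛ deriv g) n ∎
  where
  N = ℕ→ℚ (suc n)
  df-term dg-term : ℕ → ℚ
  df-term i = (ℕ→ℚ i * f i) * g (suc n ∸ i)
  dg-term i = f i * (ℕ→ℚ (suc n ∸ i) * g (suc n ∸ i))

  split : ∀ i → i ≤ suc n → N * (f i * g (suc n ∸ i)) ≡ df-term i +ℚ dg-term i
  split i i≤1+n = begin
    N * (f i * g (suc n ∸ i))
      ≡⟨ cong (λ k → ℕ→ℚ k * (f i * g (suc n ∸ i))) (ℕP.m+[n∸m]≡n i≤1+n) ⟨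
    ℕ→ℚ (i + (suc n ∸ i)) * (f i * g (suc n ∸ i))
      ≡⟨ cong (_* (f i * g (suc n ∸ i))) (ℕ→ℚ-+ i (suc n ∸ i)) ⟩
    (ℕ→ℚ i +ℚ ℕ→ℚ (suc n ∸ i)) * (f i * g (suc n ∸ i))
      ≡⟨ solve 4 (λ I J F G → (I :+ J) :* (F :* G) := (I :* F) :* G :+ F :* (J :* G)) refl
           (ℕ→ℚ i) (ℕ→ℚ (suc n ∸ i)) (f i) (g (suc n ∸ i)) ⟩
    df-term i +ℚ dg-term i ∎

  df-sum : Σ≤ (suc n) df-term ≡ (deriv f ⊛ g) n
  df-sum = begin
    Σ≤ (suc n) df-term                          ≡⟨ Σ≤-shift n df-term ⟩
    df-term 0 +ℚ Σ≤ n (λ j → df-term (suc j))   ≡⟨ cong (_+ℚ (deriv f ⊛ g) n)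
                                                     (trans (cong (_* g (suc n)) (QP.*-zeroˡ (f 0))) (QP.*-zeroˡ (g (suc n)))) ⟩
    0ℚ +ℚ (deriv f ⊛ g) n                       ≡⟨ QP.+-identityˡ _ ⟩
    (deriv f ⊛ g) n                             ∎

  dg-last : dg-term (suc n) ≡ 0ℚ
  dg-last = begin
    f (suc n) * (ℕ→ℚ (n ∸ n) * g (n ∸ n)) ≡⟨ cong (λ k → f (suc n) * (ℕ→ℚ k * g k)) (ℕP.n∸n≡0 n) ⟩
    f (suc n) * (0ℚ * g 0)                ≡⟨ cong (f (suc n) *_) (QP.*-zeroˡ (g 0)) ⟩
    f (suc n) * 0ℚ                        ≡⟨ QP.*-zeroʳ (f (suc n)) ⟩
    0ℚ                                    ∎

  dg-sum : Σ≤ (suc n) dg-term ≡ (f ⊛ deriv g) n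
  dg-sum = begin
    Σ≤ n dg-term +ℚ dg-term (suc n)
      ≡⟨ cong₂ _+ℚ_ (Σ≤-cong n (λ i i≤n → cong (λ k → f i * (ℕ→ℚ k * g k)) (ℕP.+-∸-assoc 1 i≤n))) dg-last ⟩
    (f ⊛ deriv g) n +ℚ 0ℚ
      ≡⟨ QP.+-identityʳ _ ⟩
    (f ⊛ deriv g) n ∎

-- Falling factorials and binomial coefficients

fall-1+ : ∀ y k → fall (1ℚ +ℚ y) (suc k) ≡ (1ℚ +ℚ y) * fall y k
fall-1+ y zero    = solve 1 (λ y → con 1ℚ :* ((con 1ℚ :+ y) :- con 0ℚ :* con 1ℚ) := (con 1ℚ :+ y) :* con 1ℚ) refl y
fall-1+ y (suc k) = begin
  fall (1ℚ +ℚ y) (suc k) * ((1ℚ +ℚ y) -ℚ ℕ→ℚ (suc k) * 1ℚ)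
    ≡⟨ cong₂ (λ F K → F * ((1ℚ +ℚ y) -ℚ K * 1ℚ)) (fall-1+ y k) (ℕ→ℚ-suc k) ⟩
  ((1ℚ +ℚ y) * fall y k) * ((1ℚ +ℚ y) -ℚ (1ℚ +ℚ ℕ→ℚ k) * 1ℚ)
    ≡⟨ solve 3 (λ y F K → ((con 1ℚ :+ y) :* F) :* ((con 1ℚ :+ y) :- (con 1ℚ :+ K) :* con 1ℚ)
                          := (con 1ℚ :+ y) :* (F :* (y :- K :* con 1ℚ))) refl y (fall y k) (ℕ→ℚ k) ⟩
  (1ℚ +ℚ y) * (fall y k * (y -ℚ ℕ→ℚ k * 1ℚ)) ∎

fall-self : ∀ m → fall (ℕ→ℚ m) m ≡ ℕ→ℚ (m !)
fall-self zero    = refl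
fall-self (suc m) = begin
  fall (ℕ→ℚ (suc m)) (suc m)       ≡⟨ cong (λ y → fall y (suc m)) (ℕ→ℚ-suc m) ⟩
  fall (1ℚ +ℚ ℕ→ℚ m) (suc m)       ≡⟨ fall-1+ (ℕ→ℚ m) m ⟩
  (1ℚ +ℚ ℕ→ℚ m) * fall (ℕ→ℚ m) m   ≡⟨ cong₂ _*_ (sym (ℕ→ℚ-suc m)) (fall-self m) ⟩
  ℕ→ℚ (suc m) * ℕ→ℚ (m !)          ≡⟨ ℕ→ℚ-* (suc m) (m !) ⟨
  ℕ→ℚ (suc m !)                    ∎

fall-vanish : ∀ m k → m < k → fall (ℕ→ℚ m) k ≡ 0ℚ
fall-vanish m (suc k) m<1+k with ℕP.m<1+n⇒m<n∨m≡n m<1+k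
... | inj₁ m<k  = trans (cong (_* (ℕ→ℚ m -ℚ ℕ→ℚ k * 1ℚ)) (fall-vanish m k m<k))
                        (QP.*-zeroˡ (ℕ→ℚ m -ℚ ℕ→ℚ k * 1ℚ))
... | inj₂ refl = solve 2 (λ F M → F :* (M :- M :* con 1ℚ) := con 0ℚ) refl (fall (ℕ→ℚ m) m) (ℕ→ℚ m)

binom : ℚ → ℕ → ℚ
binom y k = fall y k * invℕ (k !)

binom-vanish : ∀ m k → m < k → binom (ℕ→ℚ m) k ≡ 0ℚ
binom-vanish m k m<k = trans (cong (_* invℕ (k !)) (fall-vanish m k m<k)) (QP.*-zeroˡ (invℕ (k !)))

binom-suc : ∀ y k → binom (1ℚ +ℚ y) (suc k) ≡ binom y (suc k) +ℚ binom y k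
binom-suc y k = begin
  fall (1ℚ +ℚ y) (suc k) * invℕ (suc k ℕ.* k !)
    ≡⟨ cong₂ _*_ (fall-1+ y k) inv[1+k]! ⟩
  ((1ℚ +ℚ y) * F) * (invℕ (suc k) * invℕ (k !))
    ≡⟨ solve 5 (λ y F K I1 Ik → ((con 1ℚ :+ y) :* F) :* (I1 :* Ik)
                               := (F :* (y :- K :* con 1ℚ)) :* (I1 :* Ik) :+ F :* Ik :* ((con 1ℚ :+ K) :* I1))
         refl y F (ℕ→ℚ k) (invℕ (suc k)) (invℕ (k !)) ⟩
  (F * (y -ℚ ℕ→ℚ k * 1ℚ)) * (invℕ (suc k) * invℕ (k !)) +ℚ binom y k * ((1ℚ +ℚ ℕ→ℚ k) * invℕ (suc k))
    ≡⟨ cong₂ _+ℚ_ (cong ((F * (y -ℚ ℕ→ℚ k * 1ℚ)) *_) (sym inv[1+k]!)) (cong (binom y k *_) [1+k]/[1+k]≡1) ⟩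
  binom y (suc k) +ℚ binom y k * 1ℚ
    ≡⟨ cong (binom y (suc k) +ℚ_) (QP.*-identityʳ (binom y k)) ⟩
  binom y (suc k) +ℚ binom y k ∎
  where
  F = fall y k
  inv[1+k]! : invℕ (suc k ℕ.* k !) ≡ invℕ (suc k) * invℕ (k !)
  inv[1+k]! = invℕ-* (suc k) (k !) {{_}} {{ℕP._!≢0 k}}
  [1+k]/[1+k]≡1 : (1ℚ +ℚ ℕ→ℚ k) * invℕ (suc k) ≡ 1ℚ
  [1+k]/[1+k]≡1 = trans (cong (_* invℕ (suc k)) (sym (ℕ→ℚ-suc k))) (ℕ→ℚ*invℕ≡1 (suc k))

Σ≤-pascal : ∀ y m (a : ℕ → ℚ) → binom y (suc m) ≡ 0ℚ →
  Σ≤ m (λ k → binom y k * a k) +ℚ Σ≤ m (λ k → binom y k * a (suc k))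
    ≡ Σ≤ (suc m) (λ k → binom (1ℚ +ℚ y) k * a k)
Σ≤-pascal y m a b[1+m]≡0 = begin
  Σ≤ m (λ k → b k * a k) +ℚ Σ≤ m (λ k → b k * a (suc k))
    ≡⟨ cong (_+ℚ Σ≤ m (λ k → b k * a (suc k))) extend ⟩
  Σ≤ (suc m) (λ k → b k * a k) +ℚ Σ≤ m (λ k → b k * a (suc k))
    ≡⟨ cong (_+ℚ Σ≤ m (λ k → b k * a (suc k))) (Σ≤-shift m (λ k → b k * a k)) ⟩
  (b 0 * a 0 +ℚ Σ≤ m (λ k → b (suc k) * a (suc k))) +ℚ Σ≤ m (λ k → b k * a (suc k))
    ≡⟨ QP.+-assoc (b 0 * a 0) _ _ ⟩
  b 0 * a 0 +ℚ (Σ≤ m (λ k → b (suc k) * a (suc k)) +ℚ Σ≤ m (λ k → b k * a (suc k)))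
    ≡⟨ cong (b 0 * a 0 +ℚ_) (Σ≤-distrib-+ m (λ k → b (suc k) * a (suc k)) (λ k → b k * a (suc k))) ⟨
  b 0 * a 0 +ℚ Σ≤ m (λ k → b (suc k) * a (suc k) +ℚ b k * a (suc k))
    ≡⟨ cong (b 0 * a 0 +ℚ_) (Σ≤-cong m (λ k _ → pascal k)) ⟩
  b 0 * a 0 +ℚ Σ≤ m (λ k → binom (1ℚ +ℚ y) (suc k) * a (suc k))
    ≡⟨ Σ≤-shift m (λ k → binom (1ℚ +ℚ y) k * a k) ⟨
  Σ≤ (suc m) (λ k → binom (1ℚ +ℚ y) k * a k) ∎
  where
  b = binom y
  extend : Σ≤ m (λ k → b k * a k) ≡ Σ≤ (suc m) (λ k → b k * a k)
  extend = sym (trans (cong (Σ≤ m (λ k → b k * a k) +ℚ_)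
                            (trans (cong (_* a (suc m)) b[1+m]≡0) (QP.*-zeroˡ (a (suc m)))))
                      (QP.+-identityʳ _))
  pascal : ∀ k → b (suc k) * a (suc k) +ℚ b k * a (suc k) ≡ binom (1ℚ +ℚ y) (suc k) * a (suc k)
  pascal k = trans (sym (QP.*-distribʳ-+ (a (suc k)) (b (suc k)) (b k)))
                   (cong (_* a (suc k)) (sym (binom-suc y k)))

^ₛ-binomial : ∀ (u s : Series) → (∀ i → u i ≡ one i +ℚ s i) →
  ∀ m n → (u ^ₛ m) n ≡ Σ≤ m (λ k → binom (ℕ→ℚ m) k * (s ^ₛ k) n)
^ₛ-binomial u s u≡1+s zero    n = sym (QP.*-identityˡ (one n))
^ₛ-binomial u s u≡1+s (suc m) n = begin
  ((u ^ₛ m) ⊛ u) n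
    ≡⟨ Σ≤-cong n (λ i _ → cong ((u ^ₛ m) i *_) (u≡1+s (n ∸ i))) ⟩
  ((u ^ₛ m) ⊛ (λ i → one i +ℚ s i)) n
    ≡⟨ ⊛-distribˡ-+ (u ^ₛ m) one s n ⟩
  ((u ^ₛ m) ⊛ one) n +ℚ ((u ^ₛ m) ⊛ s) n
    ≡⟨ cong₂ _+ℚ_ (trans (⊛-identityʳ (u ^ₛ m) n) (^ₛ-binomial u s u≡1+s m n))
                  (trans (⊛-congˡ s (^ₛ-binomial u s u≡1+s m) n) (⊛-distribʳ-Σ≤ m (binom M) (s ^ₛ_) s n)) ⟩
  Σ≤ m (λ k → binom M k * (s ^ₛ k) n) +ℚ Σ≤ m (λ k → binom M k * (s ^ₛ suc k) n)
    ≡⟨ Σ≤-pascal M m (λ k → (s ^ₛ k) n) (binom-vanish m (suc m) ℕP.≤-refl) ⟩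
  Σ≤ (suc m) (λ k → binom (1ℚ +ℚ M) k * (s ^ₛ k) n)
    ≡⟨ Σ≤-cong (suc m) (λ k _ → cong (λ y → binom y k * (s ^ₛ k) n) (ℕ→ℚ-suc m)) ⟨
  Σ≤ (suc m) (λ k → binom (ℕ→ℚ (suc m)) k * (s ^ₛ k) n) ∎
  where M = ℕ→ℚ m

-- Degenerate exponentials

module _ (l : ℚ) where

  eλ^-deriv : ∀ a j → deriv (eλ^ l a) j ≡ eλ^ l a j * (a -ℚ ℕ→ℚ j * l)
  eλ^-deriv a j = begin
    ℕ→ℚ (suc j) * ((F * D) * invℕ (suc j ℕ.* j !))
      ≡⟨ cong (λ z → ℕ→ℚ (suc j) * ((F * D) * z)) (invℕ-* (suc j) (j !) {{_}} {{ℕP._!≢0 j}}) ⟩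
    ℕ→ℚ (suc j) * ((F * D) * (invℕ (suc j) * invℕ (j !)))
      ≡⟨ solve 5 (λ N F D I J → N :* ((F :* D) :* (I :* J)) := (N :* I) :* ((F :* J) :* D))
           refl (ℕ→ℚ (suc j)) F D (invℕ (suc j)) (invℕ (j !)) ⟩
    (ℕ→ℚ (suc j) * invℕ (suc j)) * (eλ^ l a j * D)
      ≡⟨ cong (_* (eλ^ l a j * D)) (ℕ→ℚ*invℕ≡1 (suc j)) ⟩
    1ℚ * (eλ^ l a j * D)
      ≡⟨ QP.*-identityˡ (eλ^ l a j * D) ⟩
    eλ^ l a j * D ∎
    where
    F = fallλ l a j
    D = a -ℚ ℕ→ℚ j * l

  -- Both sides solve (1 + λt) u' = (a + b) u, u(0) = 1: eλ^-deriv is that equation read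
  -- coefficientwise, and deriv-⊛ shows that the product solves it.
  eλ^-+ : ∀ a b n → (eλ^ l a ⊛ eλ^ l b) n ≡ eλ^ l (a +ℚ b) n
  eλ^-+ a b zero    = refl
  eλ^-+ a b (suc n) = ℕ→ℚ-*-cancelˡ (suc n) (begin
    deriv (ea ⊛ eb) n
      ≡⟨ deriv-⊛ ea eb n ⟩
    (deriv ea ⊛ eb) n +ℚ (ea ⊛ deriv eb) n
      ≡⟨ Σ≤-distrib-+ n (λ i → deriv ea i * eb (n ∸ i)) (λ i → ea i * deriv eb (n ∸ i)) ⟨
    Σ≤ n (λ i → deriv ea i * eb (n ∸ i) +ℚ ea i * deriv eb (n ∸ i))
      ≡⟨ Σ≤-cong n term ⟩
    Σ≤ n (λ i → (ea i * eb (n ∸ i)) * ((a +ℚ b) -ℚ ℕ→ℚ n * l))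
      ≡⟨ *-distribʳ-Σ≤ n ((a +ℚ b) -ℚ ℕ→ℚ n * l) (λ i → ea i * eb (n ∸ i)) ⟨
    (ea ⊛ eb) n * ((a +ℚ b) -ℚ ℕ→ℚ n * l)
      ≡⟨ cong (_* ((a +ℚ b) -ℚ ℕ→ℚ n * l)) (eλ^-+ a b n) ⟩
    eλ^ l (a +ℚ b) n * ((a +ℚ b) -ℚ ℕ→ℚ n * l)
      ≡⟨ eλ^-deriv (a +ℚ b) n ⟨
    deriv (eλ^ l (a +ℚ b)) n ∎)
    where
    ea = eλ^ l a
    eb = eλ^ l b
    term : ∀ i → i ≤ n →
      deriv ea i * eb (n ∸ i) +ℚ ea i * deriv eb (n ∸ i) ≡ (ea i * eb (n ∸ i)) * ((a +ℚ b) -ℚ ℕ→ℚ n * l)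
    term i i≤n = begin
      deriv ea i * eb (n ∸ i) +ℚ ea i * deriv eb (n ∸ i)
        ≡⟨ cong₂ (λ p q → p * eb (n ∸ i) +ℚ ea i * q) (eλ^-deriv a i) (eλ^-deriv b (n ∸ i)) ⟩
      (ea i * (a -ℚ ℕ→ℚ i * l)) * eb (n ∸ i) +ℚ ea i * (eb (n ∸ i) * (b -ℚ ℕ→ℚ (n ∸ i) * l))
        ≡⟨ cong (λ d → (ea i * (a -ℚ ℕ→ℚ i * l)) * eb (n ∸ i) +ℚ ea i * (eb (n ∸ i) * (b -ℚ d * l)))
                (ℕ→ℚ-∸ i≤n) ⟩
      (ea i * (a -ℚ ℕ→ℚ i * l)) * eb (n ∸ i) +ℚ ea i * (eb (n ∸ i) * (b -ℚ (ℕ→ℚ n -ℚ ℕ→ℚ i) * l))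
        ≡⟨ solve 7 (λ A B a b I N l → (A :* (a :- I :* l)) :* B :+ A :* (B :* (b :- (N :- I) :* l))
                                      := (A :* B) :* ((a :+ b) :- N :* l))
             refl (ea i) (eb (n ∸ i)) a b (ℕ→ℚ i) (ℕ→ℚ n) l ⟩
      (ea i * eb (n ∸ i)) * ((a +ℚ b) -ℚ ℕ→ℚ n * l) ∎

  fallλ-0-suc : ∀ i → fallλ l 0ℚ (suc i) ≡ 0ℚ
  fallλ-0-suc zero    = solve 1 (λ l → con 1ℚ :* (con 0ℚ :- con 0ℚ :* l) := con 0ℚ) refl l
  fallλ-0-suc (suc i) = trans (cong (_* (0ℚ -ℚ ℕ→ℚ (suc i) * l)) (fallλ-0-suc i)) (QP.*-zeroˡ (0ℚ -ℚ ℕ→ℚ (suc i) * l))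

  eλ^-0 : ∀ i → eλ^ l 0ℚ i ≡ one i
  eλ^-0 zero    = refl
  eλ^-0 (suc i) = trans (cong (_* invℕ (suc i !)) (fallλ-0-suc i)) (QP.*-zeroˡ (invℕ (suc i !)))

  eλ-split : ∀ i → eλ^ l 1ℚ i ≡ one i +ℚ eλ-1 l i
  eλ-split zero    = refl
  eλ-split (suc i) = sym (QP.+-identityˡ (eλ-1 l (suc i)))

  eλ^ₛ≡eλ^ : ∀ m i → (eλ^ l 1ℚ ^ₛ m) i ≡ eλ^ l (ℕ→ℚ m) i
  eλ^ₛ≡eλ^ zero    i = sym (eλ^-0 i)
  eλ^ₛ≡eλ^ (suc m) i = begin
    ((eλ^ l 1ℚ ^ₛ m) ⊛ eλ^ l 1ℚ) i   ≡⟨ ⊛-congˡ (eλ^ l 1ℚ) (eλ^ₛ≡eλ^ m) i ⟩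
    (eλ^ l (ℕ→ℚ m) ⊛ eλ^ l 1ℚ) i     ≡⟨ eλ^-+ (ℕ→ℚ m) 1ℚ i ⟩
    eλ^ l (ℕ→ℚ m +ℚ 1ℚ) i            ≡⟨ cong (λ y → eλ^ l y i) (trans (QP.+-comm (ℕ→ℚ m) 1ℚ) (sym (ℕ→ℚ-suc m))) ⟩
    eλ^ l (ℕ→ℚ (suc m)) i            ∎

  eλ^-binomial : ∀ x m n →
    Σ≤ m (λ k → binom (ℕ→ℚ m) k * ((eλ-1 l ^ₛ k) ⊛ eλ^ l x) n) ≡ eλ^ l (ℕ→ℚ m +ℚ x) n
  eλ^-binomial x m n = begin
    Σ≤ m (λ k → binom (ℕ→ℚ m) k * ((eλ-1 l ^ₛ k) ⊛ eλ^ l x) n)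
      ≡⟨ ⊛-distribʳ-Σ≤ m (binom (ℕ→ℚ m)) (eλ-1 l ^ₛ_) (eλ^ l x) n ⟨
    ((λ i → Σ≤ m (λ k → binom (ℕ→ℚ m) k * (eλ-1 l ^ₛ k) i)) ⊛ eλ^ l x) n
      ≡⟨ ⊛-congˡ (eλ^ l x) (λ i → sym (^ₛ-binomial (eλ^ l 1ℚ) (eλ-1 l) eλ-split m i)) n ⟩
    ((eλ^ l 1ℚ ^ₛ m) ⊛ eλ^ l x) n
      ≡⟨ ⊛-congˡ (eλ^ l x) (eλ^ₛ≡eλ^ m) n ⟩
    (eλ^ l (ℕ→ℚ m) ⊛ eλ^ l x) n
      ≡⟨ eλ^-+ (ℕ→ℚ m) x n ⟩
    eλ^ l (ℕ→ℚ m +ℚ x) n ∎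

-- Degenerate Stirling numbers

degStirling2 : ℚ → ℚ → ℕ → ℕ → ℚ
degStirling2 l x n k = ℕ→ℚ (n !) * (invℕ (k !) * ((eλ-1 l ^ₛ k) ⊛ eλ^ l x) n)

degStirling2-expansion : ∀ l x n m →
  fallλ l (ℕ→ℚ m +ℚ x) n ≡ Σ≤ n (λ k → degStirling2 l x n k * fall (ℕ→ℚ m) k)
degStirling2-expansion l x n m = sym (begin
  Σ≤ n (λ k → degStirling2 l x n k * fall (ℕ→ℚ m) k)
    ≡⟨ Σ≤-cong n (λ k _ → solve 4 (λ N I A F → N :* (I :* A) :* F := N :* ((F :* I) :* A))
                               refl n! (invℕ (k !)) (A k) (fall (ℕ→ℚ m) k)) ⟩
  Σ≤ n (λ k → n! * c k)
    ≡⟨ *-distribˡ-Σ≤ n n! c ⟨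
  n! * Σ≤ n c
    ≡⟨ cong (n! *_) (Σ≤-trailing-zeros (n ℕ.⊔ m) (ℕP.m≤m⊔n n m) c-beyond-n) ⟨
  n! * Σ≤ (n ℕ.⊔ m) c
    ≡⟨ cong (n! *_) (Σ≤-trailing-zeros (n ℕ.⊔ m) (ℕP.m≤n⊔m n m) c-beyond-m) ⟩
  n! * Σ≤ m c
    ≡⟨ cong (n! *_) (eλ^-binomial l x m n) ⟩
  n! * (X * invℕ (n !))
    ≡⟨ solve 3 (λ N X I → N :* (X :* I) := X :* (N :* I)) refl n! X (invℕ (n !)) ⟩
  X * (n! * invℕ (n !))
    ≡⟨ cong (X *_) (ℕ→ℚ*invℕ≡1 (n !) {{ℕP._!≢0 n}}) ⟩
  X * 1ℚ
    ≡⟨ QP.*-identityʳ X ⟩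
  X ∎)
  where
  n! = ℕ→ℚ (n !)
  X = fallλ l (ℕ→ℚ m +ℚ x) n
  A : ℕ → ℚ
  A k = ((eλ-1 l ^ₛ k) ⊛ eλ^ l x) n
  c : ℕ → ℚ
  c k = binom (ℕ→ℚ m) k * A k
  c-beyond-n : ∀ k → n < k → c k ≡ 0ℚ
  c-beyond-n k n<k = trans (cong (binom (ℕ→ℚ m) k *_)
      (⊛-vanishˡ (eλ^ l x) k (λ i i<k → ^ₛ-vanish (eλ-1 l) refl k i i<k) n n<k))
    (QP.*-zeroʳ (binom (ℕ→ℚ m) k))
  c-beyond-m : ∀ k → m < k → c k ≡ 0ℚ
  c-beyond-m k m<k = trans (cong (_* A k) (binom-vanish m k m<k)) (QP.*-zeroˡ (A k))

fall-expansion-zero : ∀ n (c : ℕ → ℚ) →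
  (∀ m → m ≤ n → Σ≤ n (λ k → c k * fall (ℕ→ℚ m) k) ≡ 0ℚ) → ∀ k → k ≤ n → c k ≡ 0ℚ
fall-expansion-zero n c vanish = <-rec (λ m → m ≤ n → c m ≡ 0ℚ) step
  where
  step : ∀ m → (∀ {k} → k < m → k ≤ n → c k ≡ 0ℚ) → m ≤ n → c m ≡ 0ℚ
  step m ih m≤n = ℕ→ℚ-*-cancelˡ (m !) {{ℕP._!≢0 m}} (begin
    ℕ→ℚ (m !) * c m                      ≡⟨ QP.*-comm (ℕ→ℚ (m !)) (c m) ⟩
    c m * ℕ→ℚ (m !)                      ≡⟨ cong (c m *_) (fall-self m) ⟨
    c m * fall (ℕ→ℚ m) m                 ≡⟨ Σ≤-single n m (λ k → c k * fall (ℕ→ℚ m) k) m≤n off-diagonal ⟨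
    Σ≤ n (λ k → c k * fall (ℕ→ℚ m) k)    ≡⟨ vanish m m≤n ⟩
    0ℚ                                   ≡⟨ QP.*-zeroʳ (ℕ→ℚ (m !)) ⟨
    ℕ→ℚ (m !) * 0ℚ                       ∎)
    where
    off-diagonal : ∀ k → k ≤ n → k ≢ m → c k * fall (ℕ→ℚ m) k ≡ 0ℚ
    off-diagonal k k≤n k≢m with ℕP.<-cmp k m
    ... | tri< k<m _ _ = trans (cong (_* fall (ℕ→ℚ m) k) (ih k<m k≤n)) (QP.*-zeroˡ (fall (ℕ→ℚ m) k))
    ... | tri≈ _ k≡m _ = contradiction k≡m k≢m
    ... | tri> _ _ m<k = trans (cong (c k *_) (fall-vanish m k m<k)) (QP.*-zeroʳ (c k))

fall-expansion-unique : ∀ n (c d : ℕ → ℚ) →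
  (∀ m → m ≤ n → Σ≤ n (λ k → c k * fall (ℕ→ℚ m) k) ≡ Σ≤ n (λ k → d k * fall (ℕ→ℚ m) k)) →
  ∀ k → k ≤ n → c k ≡ d k
fall-expansion-unique n c d agree k k≤n =
  x∙y⁻¹≈ε⇒x≈y (c k) (d k) (fall-expansion-zero n (λ k → c k -ℚ d k) difference-vanishes k k≤n)
  where
  difference-vanishes : ∀ m → m ≤ n → Σ≤ n (λ k → (c k -ℚ d k) * fall (ℕ→ℚ m) k) ≡ 0ℚ
  difference-vanishes m m≤n = begin
    Σ≤ n (λ k → (c k -ℚ d k) * fall (ℕ→ℚ m) k)
      ≡⟨ Σ≤-cong n (λ k _ → solve 3 (λ c d f → (c :- d) :* f := c :* f :- d :* f) refl (c k) (d k) (fall (ℕ→ℚ m) k)) ⟩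
    Σ≤ n (λ k → c k * fall (ℕ→ℚ m) k -ℚ d k * fall (ℕ→ℚ m) k)
      ≡⟨ Σ≤-distrib-- n (λ k → c k * fall (ℕ→ℚ m) k) (λ k → d k * fall (ℕ→ℚ m) k) ⟩
    Σ≤ n (λ k → c k * fall (ℕ→ℚ m) k) -ℚ Σ≤ n (λ k → d k * fall (ℕ→ℚ m) k)
      ≡⟨ cong (_-ℚ Σ≤ n (λ k → d k * fall (ℕ→ℚ m) k)) (agree m m≤n) ⟩
    Σ≤ n (λ k → d k * fall (ℕ→ℚ m) k) -ℚ Σ≤ n (λ k → d k * fall (ℕ→ℚ m) k)
      ≡⟨ QP.+-inverseʳ (Σ≤ n (λ k → d k * fall (ℕ→ℚ m) k)) ⟩
    0ℚ ∎

C*[p!*k!]≡[k+p]! : ∀ k p → ((k + p) C p) ℕ.* (p ! ℕ.* k !) ≡ (k + p) !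
C*[p!*k!]≡[k+p]! k p = begin
  ((k + p) C p) ℕ.* (p ! ℕ.* k !)
    ≡⟨ cong (λ j → ((k + p) C p) ℕ.* (p ! ℕ.* j !)) (ℕP.m+n∸n≡m k p) ⟨
  ((k + p) C p) ℕ.* (p ! ℕ.* (k + p ∸ p) !)
    ≡⟨ cong (ℕ._* (p ! ℕ.* (k + p ∸ p) !)) (nCk≡n!/k![n-k]! p≤k+p) ⟩
  ((k + p) ! ℕ./ (p ! ℕ.* (k + p ∸ p) !)) {{_}} ℕ.* (p ! ℕ.* (k + p ∸ p) !)
    ≡⟨ m/n*n≡m {{ℕP._!*_!≢0 p (k + p ∸ p)}} (k![n∸k]!∣n! p≤k+p) ⟩
  (k + p) ! ∎
  where
  p≤k+p : p ≤ k + p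
  p≤k+p = ℕP.m≤n+m p k

invℕ-C*invℕ-! : ∀ k p → invℕ ((k + p) C p) * invℕ (k !) ≡ ℕ→ℚ (p !) * invℕ ((k + p) !)
invℕ-C*invℕ-! k p = sym (begin
  ℕ→ℚ (p !) * invℕ ((k + p) !)
    ≡⟨ cong (λ j → ℕ→ℚ (p !) * invℕ j) (C*[p!*k!]≡[k+p]! k p) ⟨
  ℕ→ℚ (p !) * invℕ (c ℕ.* (p ! ℕ.* k !))
    ≡⟨ cong (ℕ→ℚ (p !) *_) (trans (invℕ-* c (p ! ℕ.* k !) {{c≢0}} {{ℕP._!*_!≢0 p k}})
                                   (cong (invℕ c *_) (invℕ-* (p !) (k !) {{ℕP._!≢0 p}} {{ℕP._!≢0 k}}))) ⟩
  ℕ→ℚ (p !) * (invℕ c * (invℕ (p !) * invℕ (k !)))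
    ≡⟨ solve 4 (λ P C I K → P :* (C :* (I :* K)) := (P :* I) :* (C :* K))
         refl (ℕ→ℚ (p !)) (invℕ c) (invℕ (p !)) (invℕ (k !)) ⟩
  (ℕ→ℚ (p !) * invℕ (p !)) * (invℕ c * invℕ (k !))
    ≡⟨ cong (_* (invℕ c * invℕ (k !))) (ℕ→ℚ*invℕ≡1 (p !) {{ℕP._!≢0 p}}) ⟩
  1ℚ * (invℕ c * invℕ (k !))
    ≡⟨ QP.*-identityˡ (invℕ c * invℕ (k !)) ⟩
  invℕ c * invℕ (k !) ∎)
  where
  c = (k + p) C p
  c≢0 : NonZero c
  c≢0 = ℕP.m*n≢0⇒m≢0 c {{subst NonZero (sym (C*[p!*k!]≡[k+p]! k p)) (ℕP._!≢0 (k + p))}}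

theorem14 : (lam x : ℚ) (S : ℕ → ℕ → ℚ) → IsDegStirling2 lam x S →
    (n p : ℕ) → B p lam n x ≡ Σ≤ n (λ k → invℕ ((k + p) C p) * S n k)
theorem14 lam x S hS n p = begin
  n! * (p! * Σ≤ n (λ k → invℕ ((k + p) !) * A k))
    ≡⟨ cong (n! *_) (*-distribˡ-Σ≤ n p! (λ k → invℕ ((k + p) !) * A k)) ⟩
  n! * Σ≤ n (λ k → p! * (invℕ ((k + p) !) * A k))
    ≡⟨ *-distribˡ-Σ≤ n n! (λ k → p! * (invℕ ((k + p) !) * A k)) ⟩
  Σ≤ n (λ k → n! * (p! * (invℕ ((k + p) !) * A k)))
    ≡⟨ Σ≤-cong n (λ k k≤n → trans (regroup k) (cong (invℕ ((k + p) C p) *_) (sym (S≡degStirling2 k k≤n)))) ⟩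
  Σ≤ n (λ k → invℕ ((k + p) C p) * S n k) ∎
  where
  n! = ℕ→ℚ (n !)
  p! = ℕ→ℚ (p !)
  A : ℕ → ℚ
  A k = ((eλ-1 lam ^ₛ k) ⊛ eλ^ lam x) n

  S≡degStirling2 : ∀ k → k ≤ n → S n k ≡ degStirling2 lam x n k
  S≡degStirling2 = fall-expansion-unique n (S n) (degStirling2 lam x n)
    (λ m _ → trans (sym (hS n (ℕ→ℚ m))) (degStirling2-expansion lam x n m))

  regroup : ∀ k → n! * (p! * (invℕ ((k + p) !) * A k)) ≡ invℕ ((k + p) C p) * degStirling2 lam x n k
  regroup k = begin
    n! * (p! * (invℕ ((k + p) !) * A k))
      ≡⟨ cong (n! *_) (QP.*-assoc p! (invℕ ((k + p) !)) (A k)) ⟨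
    n! * ((p! * invℕ ((k + p) !)) * A k)
      ≡⟨ cong (λ z → n! * (z * A k)) (invℕ-C*invℕ-! k p) ⟨
    n! * ((invℕ ((k + p) C p) * invℕ (k !)) * A k)
      ≡⟨ solve 4 (λ N C K A → N :* ((C :* K) :* A) := C :* (N :* (K :* A))) refl n! (invℕ ((k + p) C p)) (invℕ (k !)) (A k) ⟩
    invℕ ((k + p) C p) * degStirling2 lam x n k ∎
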